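{- For every $k\ge2$ and every $f:\binom{S}{k}\to\{0,1\}^k$, $d(U_f,\mathbf{Par}_k)\ge\frac16 d(f,\mathbf{par}_k)$.
   Context: Let $S=[m]$, $n=\binom{m-1}{k-1}$, and $C:[m]\to\{0,1\}^n$ a systematic code (minimal normalized distance at least $\frac13$, $C(a)$ determined by its first $\lceil\log_2 m\rceil$ bits). For $x\in\{0,1\}^{2n}$, the key $\kappa(x)$ is the element of $[m]$ decoded from the first $\lceil\log_2 m\rceil$ bits; $x$ has a valid key if $x_1\dots x_n=C(\kappa(x))$. The last $n$ bits of $x$ are indexed (via a fixed order) by the $(k-1)$-subsets $B$ of $S\setminus\{\kappa(x)\}$; $\phi_x(B)$ denotes the corresponding bit, and for $A\subseteq S$, $|A|=k$, $\kappa(x)\in A$, $\Phi_x(A)=\phi_x(A\setminus\{\kappa(x)\})$. $\mathbf{Par}_k$ is the set of distributions $P$ over $\{0,1\}^{2n}$ such that every $x$ in the support has a valid key and for every $A=\{a_1<\dots<a_k\}\subseteq S$, $\Pr_{x^1,\dots,x^k\sim P}[\bigwedge_i\kappa(x^i)=a_i\wedge\bigoplus_i\Phi_{x^i}(A)=1]=0$ (independent samples). $\mathbf{par}_k$ is the set of functions $g:\binom{S}{k}\to\{0,1\}^k$ with $g(A)$ of even parity for every $A$; the distance between $f,g:\binom{S}{k}\to\{0,1\}^k$ is $\mathbb{E}_{A\sim\binom{S}{k}}[d_H(f(A),g(A))]$ (Hamming distance of the $k\binom{m}{k}$-bit strings, normalized), and $d(f,\mathbf{par}_k)$ is the minimum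 over $g\in\mathbf{par}_k$. For $a\in A$, $\mathrm{ord}(a,A)=|\{a'\in A:a'\le a\}|$. $U_f$ is the distribution obtained by choosing $a\in S$ uniformly and outputting the string $C(a)$ followed by, for each $B\in\binom{S\setminus\{a\}}{k-1}$ in the fixed order, the bit $(f(B\cup\{a\}))_{\mathrm{ord}(a,B\cup\{a\})}$. Distances between distributions are earth mover's distances with respect to normalized Hamming distance, and $d(P,\mathbf{Par}_k)=\inf_{Q\in\mathbf{Par}_k}d(P,Q)$.
   Formalization: The distributions $Q\in\mathbf{Par}_k$ and the couplings in the earth mover's distance have only rational probabilities. -}

module Defs where

open import Data.Bool using (Bool; true; false; _∧_; _xor_; not; if_then_else_)
open import Data.Bool.Properties using () renaming (_≟_ to _≟B_)
open import Data.Nat using (ℕ; zero; suc; _+_; _*_; _∸_; _≤_; _≤ᵇ_)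
open import Data.Nat.Combinatorics using (_C_)
open import Data.Nat.Logarithm using (⌈log₂_⌉)
open import Data.Fin using (Fin; toℕ)
open import Data.Fin.Subset using (Subset; ∣_∣; _∪_; _-_; ⁅_⁆)
open import Data.Vec using (Vec; []; _∷_; _++_; take; drop; tabulate; lookup; toList)
open import Data.Vec.Properties using (≡-dec)
import Data.List.Properties
import Data.Nat
open import Data.List as List using (List; []; _∷_; length; map; filter; allFin; concatMap)
open import Data.Nat.ListAction using (sum)
open import Data.List.Membership.Propositional using () renaming (_∈_ to _∈L_)
open import Data.Maybe using (Maybe; just; nothing)
open import Data.Product using (_×_; _,_; proj₁; proj₂; ∃-syntax)
open import Relation.Binary.PropositionalEquality using (_≡_; _≢_)
open import Relation.Nullary using (yes; no)

nn : ℕ → ℕ → ℕ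
nn m k = (m ∸ 1) C (k ∸ 1)

Bits2 : ℕ → ℕ → Set
Bits2 m k = Vec Bool (nn m k + nn m k)

ham : ∀ {l} → Vec Bool l → Vec Bool l → ℕ
ham []       []       = 0
ham (x ∷ xs) (y ∷ ys) = (if x xor y then 1 else 0) + ham xs ys

parity : ∀ {l} → Vec Bool l → Bool
parity []       = false
parity (x ∷ xs) = x xor parity xs

countF : ∀ {m} → (Fin m → Bool) → ℕ
countF {m} p = length (filter (λ a → p a ≟B true) (allFin m))

xorF : ∀ {m} → (Fin m → Bool) → (Fin m → Bool) → Bool
xorF {m} p h = List.foldr _xor_ false (map h (filter (λ a → p a ≟B true) (allFin m)))

-- lookup by a natural-number index (false when out of range)
lookupℕ : ∀ {l} → Vec Bool l → ℕ → Bool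
lookupℕ []       _       = false
lookupℕ (x ∷ xs) zero    = x
lookupℕ (x ∷ xs) (suc i) = lookupℕ xs i

-- ord(a, A) = |{ a' ∈ A : a' ≤ a }|   (1-based)
ordIn : ∀ {m} → Fin m → Subset m → ℕ
ordIn a A = countF (λ a' → lookup A a' ∧ (toℕ a' ≤ᵇ toℕ a))

kSubsets : ∀ m → ℕ → List (Subset m)
kSubsets m k = filter (λ A → Data.Nat._≟_ ∣ A ∣ k) (allSubsets m)
  where
  allSubsets : ∀ m → List (Subset m)
  allSubsets zero    = [] ∷ []
  allSubsets (suc m) = concatMap (λ A → (true ∷ A) ∷ (false ∷ A) ∷ []) (allSubsets m)

count : ∀ {l} → Vec Bool l → List (Vec Bool l) → ℕ
count x xs = length (filter (λ y → ≡-dec _≟B_ x y) xs)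

L : ℕ → ℕ
L m = ⌈log₂ m ⌉

prefixL : ∀ {l} → ℕ → Vec Bool l → List Bool
prefixL m v = List.take (L m) (toList v)

IsSystematicCode : ∀ m k → (Fin m → Vec Bool (nn m k)) → Set
IsSystematicCode m k Cd =
  (∀ a b → a ≢ b → nn m k ≤ 3 * ham (Cd a) (Cd b)) ×
  (∀ a b → prefixL m (Cd a) ≡ prefixL m (Cd b) → a ≡ b)

key : ∀ m k → (Fin m → Vec Bool (nn m k)) → Bits2 m k → Maybe (Fin m)
key m k Cd x = go (allFin m)
  where
  go : List (Fin m) → Maybe (Fin m)
  go []       = nothing
  go (a ∷ as) with Data.List.Properties.≡-dec _≟B_ (prefixL m (Cd a)) (prefixL m x)
  ... | yes _ = just a
  ... | no  _ = go as

HasValidKey : ∀ m k → (Fin m → Vec Bool (nn m k)) → Bits2 m k → Set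
HasValidKey m k Cd x = ∃[ a ] (key m k Cd x ≡ just a × take (nn m k) x ≡ Cd a)

IsOrder : ∀ m k → (Fin m → Fin (nn m k) → Subset m) → (Fin m → Subset m → Fin (nn m k)) → Set
IsOrder m k enum pos =
  (∀ a i → ∣ enum a i ∣ ≡ k ∸ 1 × lookup (enum a i) a ≡ false) ×
  (∀ a i → pos a (enum a i) ≡ i) ×
  (∀ a B → ∣ B ∣ ≡ k ∸ 1 → lookup B a ≡ false → enum a (pos a B) ≡ B)

-- φ_x(B) when κ(x) = a
phi : ∀ m k → (Fin m → Subset m → Fin (nn m k)) → Fin m → Bits2 m k → Subset m → Bool
phi m k pos a x B = lookup (drop (nn m k) x) (pos a B)

Phi : ∀ m k → (Fin m → Subset m → Fin (nn m k)) → Fin m → Bits2 m k → Subset m → Bool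
Phi m k pos a x A = phi m k pos a x (A - a)

-- Distributions with rational probabilities are represented as
-- empirical distributions of finite nonempty lists (uniform over the
-- list, with multiplicity).

SameDist : ∀ {l} → List (Vec Bool l) → List (Vec Bool l) → Set
SameDist P Q = ∀ x → count x P * length Q ≡ count x Q * length P

-- Q ∈ Par_k.  Since probabilities are nonnegative, the probability of the
-- forbidden event is 0 iff no tuple of support elements realises it.
InPar : ∀ m k → (Fin m → Vec Bool (nn m k)) → (Fin m → Subset m → Fin (nn m k)) →
        List (Bits2 m k) → Set
InPar m k Cd pos Q =
  (∀ x → x ∈L Q → HasValidKey m k Cd x) ×
  (∀ (A : Subset m) → ∣ A ∣ ≡ k → (sel : Fin m → Bits2 m k) →
     (∀ a → lookup A a ≡ true → sel a ∈L Q × key m k Cd (sel a) ≡ just a) →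
     xorF (lookup A) (λ a → Phi m k pos a (sel a) A) ≡ false)

uString : ∀ m k → (Fin m → Vec Bool (nn m k)) → (Fin m → Fin (nn m k) → Subset m) →
          (Subset m → Vec Bool k) → Fin m → Bits2 m k
uString m k Cd enum f a =
  Cd a ++ tabulate (λ i → let A = enum a i ∪ ⁅ a ⁆ in lookupℕ (f A) (ordIn a A ∸ 1))

U : ∀ m k → (Fin m → Vec Bool (nn m k)) → (Fin m → Fin (nn m k) → Subset m) →
    (Subset m → Vec Bool k) → List (Bits2 m k)
U m k Cd enum f = map (uString m k Cd enum f) (allFin m)

IsCoupling : ∀ {l} → List (Vec Bool l) → List (Vec Bool l) → List (Vec Bool l × Vec Bool l) → Set
IsCoupling P Q π = 1 ≤ length π × SameDist (map proj₁ π) P × SameDist (map proj₂ π) Q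

-- unnormalised transport cost of π (normalised cost = costπ / (2n·|π|))
cost : ∀ {l} → List (Vec Bool l × Vec Bool l) → ℕ
cost π = sum (map (λ p → ham (proj₁ p) (proj₂ p)) π)

InParF : ∀ m k → (Subset m → Vec Bool k) → Set
InParF m k g = ∀ A → ∣ A ∣ ≡ k → parity (g A) ≡ false

-- unnormalised distance: normalised d(f,g) = distF / (k · binom(m,k))
distF : ∀ m k → (Subset m → Vec Bool k) → (Subset m → Vec Bool k) → ℕ
distF m k f g = sum (map (λ A → ham (f A) (g A)) (kSubsets m k))

-- Repair f by rewriting the first bit of every odd f(A) (fixParity), so that d(f, par_k) is at
-- most the number of k-sets A with f(A) odd.  Charge each odd A to one of its elements a: to an
-- element that is the key of no string of Q if there is one, and otherwise to an element where
-- f(A)_{ord(a,A)} differs from Φ_x(A) for a string x of Q with key a; such an element exists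
-- because the Par_k condition makes the Φ_x(A) xor to 0 while the f-bits xor to 1.  The same
-- condition shows that Φ_x(A) depends only on the key of x, so the total charge of a is at most
-- the Hamming distance from a's string in U_f to any string of Q with key a, and at most
-- n ≤ 3 d_H(C(a), C(b)) against strings with another key b.  Averaging over a coupling of U_f and
-- Q bounds the number of odd sets by 3m times the transport cost, and k·C(m,k) = m·n gives the
-- normalised inequality.

{-# OPTIONS --safe #-}
module Submission where

open import Defs
open import Algebra using (CommutativeRing)
open import Data.Bool using (Bool; true; false; not; _∧_; _xor_; if_then_else_)
open import Data.Bool.Properties
  using (∧-identityʳ; ∧-zeroʳ; ∨-zeroʳ; ∨-identityʳ; xor-same; xor-comm; xor-∧-commutativeRing)
  renaming (_≟_ to _≟B_)
open import Algebra.Properties.Group (CommutativeRing.+-group xor-∧-commutativeRing)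
  using (∙-cancelˡ; ∙-cancelʳ)
open import Data.Fin using (Fin; zero; suc; toℕ) renaming (_≟_ to _≟F_)
import Data.Fin.Properties as Fin
open import Data.Fin.Subset using (Subset; ∣_∣; _∪_; _─_; _-_; ⁅_⁆; ⊥)
open import Data.Fin.Subset.Properties using (∪-identityʳ; p─⊥≡p)
open import Data.List using (List; []; _∷_; map; filter; length; allFin; concatMap; foldr)
open import Data.List.Properties using (map-tabulate; length-map; length-tabulate; filter-some)
open import Data.List.Membership.Propositional using (_∈_; find; lose)
open import Data.List.Membership.Propositional.Properties using (∈-allFin; ∈-map⁺; ∈-filter⁻)
open import Data.List.Relation.Unary.Any using (Any; here; there; any?)
open import Data.Maybe using (just)
open import Data.Maybe.Properties using () renaming (≡-dec to ≡-decᴹ)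
open import Data.Nat using (ℕ; zero; suc; _+_; _*_; _∸_; _≤_; _≤ᵇ_; z≤n; s≤s)
open import Data.Nat.Properties
open import Data.Nat.ListAction using (sum)
open import Data.Nat.Combinatorics using (_C_; nC1≡n; nCk+nC[k+1]≡[n+1]C[k+1])
open import Data.Nat.Combinatorics.Specification using (k>n⇒nCk≡0)
open import Data.Nat.Tactic.RingSolver using (solve-∀)
open import Data.Product as Product using (_×_; _,_; proj₁; proj₂; ∃-syntax)
open import Data.Vec using (Vec; []; _∷_; lookup; _++_; take; drop; replicate)
  renaming (tabulate to tabulateᵛ)
open import Data.Vec.Properties using (≡-dec; take++drop≡id; ++-injectiveˡ)
open import Data.Vec.Functional using (updateAt)
open import Data.Vec.Functional.Properties using (updateAt-updates; updateAt-minimal)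
open import Function using (_∘_; id; const)
open import Function.Definitions using (Injective)
open import Relation.Binary.PropositionalEquality
open import Relation.Nullary using (Dec; yes; no; does; ¬_; contradiction)
open import Relation.Nullary.Decidable using (dec-true; dec-false; decidable-stable; _×-dec_; ¬?)
open import Relation.Unary using (Pred; Decidable)

𝟙 : Bool → ℕ
𝟙 b = if b then 1 else 0

𝟙≤1 : ∀ b → 𝟙 b ≤ 1
𝟙≤1 true  = ≤-refl
𝟙≤1 false = z≤n

∑ : ∀ {a} {A : Set a} → List A → (A → ℕ) → ℕ
∑ xs F = sum (map F xs)

infix 5 ∑
syntax ∑ xs (λ x → F) = ∑[ x ∈ xs ] F

module _ {a} {A : Set a} where

  ∑-cong : ∀ xs {F G : A → ℕ} → (∀ x → F x ≡ G x) → ∑ xs F ≡ ∑ xs G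
  ∑-cong []       F≡G = refl
  ∑-cong (x ∷ xs) F≡G = cong₂ _+_ (F≡G x) (∑-cong xs F≡G)

  ∑-mono-≤ : ∀ xs {F G : A → ℕ} → (∀ {x} → x ∈ xs → F x ≤ G x) → ∑ xs F ≤ ∑ xs G
  ∑-mono-≤ []       F≤G = z≤n
  ∑-mono-≤ (x ∷ xs) F≤G = +-mono-≤ (F≤G (here refl)) (∑-mono-≤ xs (F≤G ∘ there))

  ∑-zero : ∀ xs {F : A → ℕ} → (∀ x → F x ≡ 0) → ∑ xs F ≡ 0
  ∑-zero []       F≡0 = refl
  ∑-zero (x ∷ xs) F≡0 = cong₂ _+_ (F≡0 x) (∑-zero xs F≡0)

  ∑-distrib-+ : ∀ xs (F G : A → ℕ) → ∑[ x ∈ xs ] (F x + G x) ≡ ∑ xs F + ∑ xs G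
  ∑-distrib-+ []       F G = refl
  ∑-distrib-+ (x ∷ xs) F G =
    trans (cong (F x + G x +_) (∑-distrib-+ xs F G)) (interchange (F x) (G x) (∑ xs F) (∑ xs G))
    where
    interchange : ∀ a b c d → a + b + (c + d) ≡ a + c + (b + d)
    interchange = solve-∀

  *-distribˡ-∑ : ∀ c xs (F : A → ℕ) → c * ∑ xs F ≡ ∑[ x ∈ xs ] c * F x
  *-distribˡ-∑ c []       F = *-zeroʳ c
  *-distribˡ-∑ c (x ∷ xs) F =
    trans (*-distribˡ-+ c (F x) (∑ xs F)) (cong (c * F x +_) (*-distribˡ-∑ c xs F))

  *-distribʳ-∑ : ∀ c xs (F : A → ℕ) → ∑ xs F * c ≡ ∑[ x ∈ xs ] F x * c
  *-distribʳ-∑ c []       F = refl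
  *-distribʳ-∑ c (x ∷ xs) F =
    trans (*-distribʳ-+ c (F x) (∑ xs F)) (cong (F x * c +_) (*-distribʳ-∑ c xs F))

  ∈⇒≤∑ : ∀ {xs x} (F : A → ℕ) → x ∈ xs → F x ≤ ∑ xs F
  ∈⇒≤∑ {y ∷ xs} F (here refl) = m≤m+n (F y) (∑ xs F)
  ∈⇒≤∑ {y ∷ xs} F (there x∈xs) = ≤-trans (∈⇒≤∑ F x∈xs) (m≤n+m (∑ xs F) (F y))

  ∑≤length : ∀ xs {F : A → ℕ} → (∀ x → F x ≤ 1) → ∑ xs F ≤ length xs
  ∑≤length []       F≤1 = z≤n
  ∑≤length (x ∷ xs) F≤1 = +-mono-≤ (F≤1 x) (∑≤length xs F≤1)

  length-filter≡∑ : ∀ {p} {P : Pred A p} (P? : Decidable P) xs →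
    length (filter P? xs) ≡ ∑[ x ∈ xs ] 𝟙 (does (P? x))
  length-filter≡∑ P? []       = refl
  length-filter≡∑ P? (x ∷ xs) with does (P? x)
  ... | true  = cong suc (length-filter≡∑ P? xs)
  ... | false = length-filter≡∑ P? xs

module _ {a b} {A : Set a} {B : Set b} where

  ∑-map : ∀ (g : B → A) xs (F : A → ℕ) → ∑ (map g xs) F ≡ ∑[ y ∈ xs ] F (g y)
  ∑-map g []       F = refl
  ∑-map g (y ∷ ys) F = cong (F (g y) +_) (∑-map g ys F)

  ∑-comm : ∀ (xs : List A) (ys : List B) (F : A → B → ℕ) →
    ∑[ x ∈ xs ] ∑[ y ∈ ys ] F x y ≡ ∑[ y ∈ ys ] ∑[ x ∈ xs ] F x y
  ∑-comm []       ys F = sym (∑-zero ys (λ _ → refl))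
  ∑-comm (x ∷ xs) ys F = trans (cong (∑ ys (F x) +_) (∑-comm xs ys F)) (sym (∑-distrib-+ ys (F x) _))

map-allFin-suc : ∀ {a} {A : Set a} {n} (g : Fin (suc n) → A) →
  map g (allFin (suc n)) ≡ g zero ∷ map (g ∘ suc) (allFin n)
map-allFin-suc g = cong (g zero ∷_) (trans (map-tabulate suc g) (sym (map-tabulate id (g ∘ suc))))

∑-allFin-suc : ∀ {n} (F : Fin (suc n) → ℕ) → ∑ (allFin (suc n)) F ≡ F zero + (∑[ i ∈ allFin n ] F (suc i))
∑-allFin-suc F = cong sum (map-allFin-suc F)

ham-refl : ∀ {l} (v : Vec Bool l) → ham v v ≡ 0
ham-refl []      = refl
ham-refl (x ∷ v) = cong₂ _+_ (cong 𝟙 (xor-same x)) (ham-refl v)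

ham-++ : ∀ {n l} (u u′ : Vec Bool n) (v v′ : Vec Bool l) → ham (u ++ v) (u′ ++ v′) ≡ ham u u′ + ham v v′
ham-++ []      []        v v′ = refl
ham-++ (x ∷ u) (x′ ∷ u′) v v′ =
  trans (cong (𝟙 (x xor x′) +_) (ham-++ u u′ v v′)) (sym (+-assoc (𝟙 (x xor x′)) (ham u u′) (ham v v′)))

ham-++-split : ∀ {n l} (u : Vec Bool n) (v : Vec Bool l) x →
  ham (u ++ v) x ≡ ham u (take n x) + ham v (drop n x)
ham-++-split {n} u v x =
  trans (cong (ham (u ++ v)) (sym (take++drop≡id n x))) (ham-++ u (take n x) v (drop n x))

ham-tabulate : ∀ {l} (t : Fin l → Bool) w → ham (tabulateᵛ t) w ≡ ∑[ i ∈ allFin l ] 𝟙 (t i xor lookup w i)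
ham-tabulate {zero}  t []      = refl
ham-tabulate {suc l} t (x ∷ w) =
  trans (cong (𝟙 (t zero xor x) +_) (ham-tabulate (t ∘ suc) w))
        (sym (∑-allFin-suc (λ i → 𝟙 (t i xor lookup (x ∷ w) i))))

fixParity : ∀ {l} → Vec Bool l → Vec Bool l
fixParity []      = []
fixParity (x ∷ v) = parity v ∷ v

parity-fixParity : ∀ {l} (v : Vec Bool l) → parity (fixParity v) ≡ false
parity-fixParity []      = refl
parity-fixParity (x ∷ v) = xor-same (parity v)

ham-fixParity : ∀ {l} (v : Vec Bool l) → ham v (fixParity v) ≡ 𝟙 (parity v)
ham-fixParity []      = refl
ham-fixParity (x ∷ v) = trans (cong (𝟙 (x xor parity v) +_) (ham-refl v)) (+-identityʳ _)

xor-filter≡xor-∧ : ∀ {m} (p h : Fin m → Bool) xs →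
  foldr _xor_ false (map h (filter (λ a → p a ≟B true) xs)) ≡
  foldr _xor_ false (map (λ a → p a ∧ h a) xs)
xor-filter≡xor-∧ p h []       = refl
xor-filter≡xor-∧ p h (x ∷ xs) with p x
... | true  = cong (h x xor_) (xor-filter≡xor-∧ p h xs)
... | false = xor-filter≡xor-∧ p h xs

xorF-suc : ∀ {m} (p h : Fin (suc m) → Bool) → xorF p h ≡ (p zero ∧ h zero) xor xorF (p ∘ suc) (h ∘ suc)
xorF-suc {m} p h = begin
  xorF p h
    ≡⟨ xor-filter≡xor-∧ p h (allFin (suc m)) ⟩
  foldr _xor_ false (map (λ a → p a ∧ h a) (allFin (suc m)))
    ≡⟨ cong (foldr _xor_ false) (map-allFin-suc (λ a → p a ∧ h a)) ⟩
  (p zero ∧ h zero) xor foldr _xor_ false (map (λ a → p (suc a) ∧ h (suc a)) (allFin m))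
    ≡⟨ cong ((p zero ∧ h zero) xor_) (sym (xor-filter≡xor-∧ (p ∘ suc) (h ∘ suc) (allFin m))) ⟩
  (p zero ∧ h zero) xor xorF (p ∘ suc) (h ∘ suc)
    ∎
  where open ≡-Reasoning

∧-congˡ-if : ∀ b {x y} → (b ≡ true → x ≡ y) → b ∧ x ≡ b ∧ y
∧-congˡ-if true  x≡y = x≡y refl
∧-congˡ-if false _   = refl

xorF-cong-suc : ∀ {m} (p h h′ : Fin (suc m) → Bool) → (p zero ≡ true → h zero ≡ h′ zero) →
  xorF (p ∘ suc) (h ∘ suc) ≡ xorF (p ∘ suc) (h′ ∘ suc) → xorF p h ≡ xorF p h′
xorF-cong-suc p h h′ head tail =
  trans (xorF-suc p h) (trans (cong₂ _xor_ (∧-congˡ-if (p zero) head) tail) (sym (xorF-suc p h′)))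

xorF-cong : ∀ {m} (p h h′ : Fin m → Bool) → (∀ a → p a ≡ true → h a ≡ h′ a) → xorF p h ≡ xorF p h′
xorF-cong {zero}  p h h′ h≡h′ = refl
xorF-cong {suc m} p h h′ h≡h′ =
  xorF-cong-suc p h h′ (h≡h′ zero) (xorF-cong (p ∘ suc) (h ∘ suc) (h′ ∘ suc) (h≡h′ ∘ suc))

xorF-≢ : ∀ {m} (p h h′ : Fin m → Bool) → xorF p h ≢ xorF p h′ → ∃[ a ] (p a ≡ true × h a ≢ h′ a)
xorF-≢ {zero}  p h h′ xor≢ = contradiction refl xor≢
xorF-≢ {suc m} p h h′ xor≢ = headOrTail (p zero ≟B true) (h zero ≟B h′ zero)
  where
  inTail : (p zero ≡ true → h zero ≡ h′ zero) → ∃[ a ] (p a ≡ true × h a ≢ h′ a)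
  inTail head =
    Product.map suc id (xorF-≢ (p ∘ suc) (h ∘ suc) (h′ ∘ suc) (xor≢ ∘ xorF-cong-suc p h h′ head))
  headOrTail : Dec (p zero ≡ true) → Dec (h zero ≡ h′ zero) → ∃[ a ] (p a ≡ true × h a ≢ h′ a)
  headOrTail (yes p₀) (no h₀≢h′₀) = zero , p₀ , h₀≢h′₀
  headOrTail (yes _)  (yes h₀≡h′₀) = inTail (const h₀≡h′₀)
  headOrTail (no ¬p₀) _ = inTail (λ p₀ → contradiction p₀ ¬p₀)

xorF-cancel : ∀ {m} (p h h′ : Fin m → Bool) {a} → p a ≡ true → (∀ b → b ≢ a → h b ≡ h′ b) →
  xorF p h ≡ xorF p h′ → h a ≡ h′ a
xorF-cancel {suc m} p h h′ {zero} p₀ agree xor≡ = subst (λ b → b ∧ h zero ≡ b ∧ h′ zero) p₀ heads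
  where
  tails : xorF (p ∘ suc) (h ∘ suc) ≡ xorF (p ∘ suc) (h′ ∘ suc)
  tails = xorF-cong (p ∘ suc) (h ∘ suc) (h′ ∘ suc) (λ b _ → agree (suc b) λ ())
  heads : p zero ∧ h zero ≡ p zero ∧ h′ zero
  heads = ∙-cancelʳ (xorF (p ∘ suc) (h ∘ suc)) _ _
    (trans (sym (xorF-suc p h))
           (trans xor≡ (trans (xorF-suc p h′) (cong (p zero ∧ h′ zero xor_) (sym tails)))))
xorF-cancel {suc m} p h h′ {suc a} pa agree xor≡ =
  xorF-cancel (p ∘ suc) (h ∘ suc) (h′ ∘ suc) pa (λ b b≢a → agree (suc b) (b≢a ∘ Fin.suc-injective)) tails
  where
  heads : p zero ∧ h zero ≡ p zero ∧ h′ zero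
  heads = cong (p zero ∧_) (agree zero λ ())
  tails : xorF (p ∘ suc) (h ∘ suc) ≡ xorF (p ∘ suc) (h′ ∘ suc)
  tails = ∙-cancelˡ (p zero ∧ h zero) _ _
    (trans (sym (xorF-suc p h)) (trans xor≡ (trans (xorF-suc p h′) (cong (_xor _) (sym heads)))))

does-≟true : ∀ b → does (b ≟B true) ≡ b
does-≟true true  = refl
does-≟true false = refl

countF≡∑ : ∀ {m} (p : Fin m → Bool) → countF p ≡ ∑[ a ∈ allFin m ] 𝟙 (p a)
countF≡∑ {m} p =
  trans (length-filter≡∑ (λ a → p a ≟B true) (allFin m)) (∑-cong (allFin m) (cong 𝟙 ∘ does-≟true ∘ p))

≤ᵇ-suc : ∀ x y → (suc x ≤ᵇ suc y) ≡ (x ≤ᵇ y)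
≤ᵇ-suc zero    y = refl
≤ᵇ-suc (suc x) y = refl

ordIn-∷ : ∀ {m} b (A : Subset m) a →
  ordIn a (b ∷ A) ≡ 𝟙 b + (∑[ a′ ∈ allFin m ] 𝟙 (lookup A a′ ∧ (suc (toℕ a′) ≤ᵇ toℕ a)))
ordIn-∷ b A a =
  trans (countF≡∑ below) (trans (∑-allFin-suc (𝟙 ∘ below)) (cong (_+ _) (cong 𝟙 (∧-identityʳ b))))
  where
  below : Fin _ → Bool
  below a′ = lookup (b ∷ A) a′ ∧ (toℕ a′ ≤ᵇ toℕ a)

ordIn-zero : ∀ {m} b (A : Subset m) → ordIn zero (b ∷ A) ≡ 𝟙 b
ordIn-zero {m} b A = trans (ordIn-∷ b A zero)
  (trans (cong (𝟙 b +_) (∑-zero (allFin m) (cong 𝟙 ∘ ∧-zeroʳ ∘ lookup A))) (+-identityʳ (𝟙 b)))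

ordIn-suc : ∀ {m} b (A : Subset m) a → ordIn (suc a) (b ∷ A) ≡ 𝟙 b + ordIn a A
ordIn-suc {m} b A a =
  trans (ordIn-∷ b A (suc a)) (cong (𝟙 b +_) (trans (∑-cong (allFin m) suc≤ᵇsuc) (sym (countF≡∑ below))))
  where
  below : Fin m → Bool
  below a′ = lookup A a′ ∧ (toℕ a′ ≤ᵇ toℕ a)
  suc≤ᵇsuc : ∀ a′ → 𝟙 (lookup A a′ ∧ (suc (toℕ a′) ≤ᵇ suc (toℕ a))) ≡ 𝟙 (below a′)
  suc≤ᵇsuc a′ = cong (λ t → 𝟙 (lookup A a′ ∧ t)) (≤ᵇ-suc (toℕ a′) (toℕ a))

ordIn≥1 : ∀ {m} (A : Subset m) a → lookup A a ≡ true → 1 ≤ ordIn a A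
ordIn≥1 (b ∷ A) zero    a∈A = ≤-reflexive (sym (trans (ordIn-zero b A) (cong 𝟙 a∈A)))
ordIn≥1 (b ∷ A) (suc a) a∈A =
  ≤-trans (ordIn≥1 A a a∈A) (≤-trans (m≤n+m _ (𝟙 b)) (≤-reflexive (sym (ordIn-suc b A a))))

-- ordBit (f A) A a is the paper's f(A)_{ord(a,A)}; ordIn is 1-based, lookupℕ 0-based.
ordBit : ∀ {l m} → Vec Bool l → Subset m → Fin m → Bool
ordBit v A a = lookupℕ v (ordIn a A ∸ 1)

lookupℕ-∷ : ∀ {l} x (v : Vec Bool l) {r} → 1 ≤ r → lookupℕ (x ∷ v) r ≡ lookupℕ v (r ∸ 1)
lookupℕ-∷ x v (s≤s z≤n) = refl

parity≡xorF-ordBit : ∀ {m l} (A : Subset m) (v : Vec Bool l) → ∣ A ∣ ≡ l →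
  parity v ≡ xorF (lookup A) (ordBit v A)
parity≡xorF-ordBit []         []      _    = refl
parity≡xorF-ordBit (true ∷ A) (x ∷ v) size = begin
  x xor parity v
    ≡⟨ cong₂ _xor_ (cong (λ r → lookupℕ (x ∷ v) (r ∸ 1)) (ordIn-zero true A))
                   (sym (trans (parity≡xorF-ordBit A v (suc-injective size)) (xorF-cong (lookup A) _ _ shifted))) ⟨
  ordBit (x ∷ v) (true ∷ A) zero xor xorF (lookup A) (ordBit (x ∷ v) (true ∷ A) ∘ suc)
    ≡⟨ xorF-suc (lookup (true ∷ A)) (ordBit (x ∷ v) (true ∷ A)) ⟨
  xorF (lookup (true ∷ A)) (ordBit (x ∷ v) (true ∷ A)) ∎
  where
  open ≡-Reasoning
  shifted : ∀ a → lookup A a ≡ true → ordBit v A a ≡ ordBit (x ∷ v) (true ∷ A) (suc a)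
  shifted a a∈A = trans (sym (lookupℕ-∷ x v (ordIn≥1 A a a∈A)))
                        (cong (λ r → lookupℕ (x ∷ v) (r ∸ 1)) (sym (ordIn-suc true A a)))
parity≡xorF-ordBit (false ∷ A) v size = begin
  parity v
    ≡⟨ parity≡xorF-ordBit A v size ⟩
  xorF (lookup A) (ordBit v A)
    ≡⟨ xorF-cong (lookup A) _ _ (λ a _ → cong (λ r → lookupℕ v (r ∸ 1)) (sym (ordIn-suc false A a))) ⟩
  xorF (lookup A) (ordBit v (false ∷ A) ∘ suc)
    ≡⟨ xorF-suc (lookup (false ∷ A)) (ordBit v (false ∷ A)) ⟨
  xorF (lookup (false ∷ A)) (ordBit v (false ∷ A)) ∎
  where open ≡-Reasoning

x∈p∪⁅x⁆ : ∀ {n} (p : Subset n) x → lookup (p ∪ ⁅ x ⁆) x ≡ true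
x∈p∪⁅x⁆ (b ∷ p) zero    = ∨-zeroʳ b
x∈p∪⁅x⁆ (b ∷ p) (suc x) = x∈p∪⁅x⁆ p x

x∉p-x : ∀ {n} (p : Subset n) x → lookup (p - x) x ≡ false
x∉p-x (b ∷ p) zero    = refl
x∉p-x (b ∷ p) (suc x) = x∉p-x p x

p∪⁅x⁆-x≡p : ∀ {n} (p : Subset n) x → lookup p x ≡ false → (p ∪ ⁅ x ⁆) - x ≡ p
p∪⁅x⁆-x≡p (false ∷ p) zero    refl = cong (false ∷_) (trans (cong (_─ ⊥) (∪-identityʳ p)) (p─⊥≡p p))
p∪⁅x⁆-x≡p (b ∷ p)     (suc x) x∉p  = cong₂ _∷_ (∨-identityʳ b) (p∪⁅x⁆-x≡p p x x∉p)

p-x∪⁅x⁆≡p : ∀ {n} (p : Subset n) x → lookup p x ≡ true → (p - x) ∪ ⁅ x ⁆ ≡ p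
p-x∪⁅x⁆≡p (true ∷ p) zero    refl = cong (true ∷_) (trans (∪-identityʳ (p ─ ⊥)) (p─⊥≡p p))
p-x∪⁅x⁆≡p (b ∷ p)    (suc x) x∈p  = cong₂ _∷_ (∨-identityʳ b) (p-x∪⁅x⁆≡p p x x∈p)

∣p-x∣+1≡∣p∣ : ∀ {n} (p : Subset n) x → lookup p x ≡ true → suc ∣ p - x ∣ ≡ ∣ p ∣
∣p-x∣+1≡∣p∣ (true ∷ p)  zero    refl = cong (suc ∘ ∣_∣) (p─⊥≡p p)
∣p-x∣+1≡∣p∣ (true ∷ p)  (suc x) x∈p  = cong suc (∣p-x∣+1≡∣p∣ p x x∈p)
∣p-x∣+1≡∣p∣ (false ∷ p) (suc x) x∈p  = ∣p-x∣+1≡∣p∣ p x x∈p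

∣p∪⁅x⁆∣≡∣p∣+1 : ∀ {n} (p : Subset n) x → lookup p x ≡ false → ∣ p ∪ ⁅ x ⁆ ∣ ≡ suc ∣ p ∣
∣p∪⁅x⁆∣≡∣p∣+1 p x x∉p =
  trans (sym (∣p-x∣+1≡∣p∣ (p ∪ ⁅ x ⁆) x (x∈p∪⁅x⁆ p x))) (cong (suc ∘ ∣_∣) (p∪⁅x⁆-x≡p p x x∉p))

δ : ∀ {l} → Vec Bool l → Vec Bool l → ℕ
δ x y = 𝟙 (does (≡-dec _≟B_ x y))

δ-refl : ∀ {l} (x : Vec Bool l) → δ x x ≡ 1
δ-refl x = cong 𝟙 (dec-true (≡-dec _≟B_ x x) refl)

δ-sym : ∀ {l} (x y : Vec Bool l) → δ x y ≡ δ y x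
δ-sym x y with ≡-dec _≟B_ x y | ≡-dec _≟B_ y x
... | yes _   | yes _   = refl
... | no _    | no _    = refl
... | yes x≡y | no y≢x  = contradiction (sym x≡y) y≢x
... | no x≢y  | yes y≡x = contradiction (sym y≡x) x≢y

count≡∑δ : ∀ {l} (x : Vec Bool l) xs → count x xs ≡ ∑[ y ∈ xs ] δ x y
count≡∑δ x = length-filter≡∑ (≡-dec _≟B_ x)

∈⇒count≥1 : ∀ {l} {x : Vec Bool l} {xs} → x ∈ xs → 1 ≤ count x xs
∈⇒count≥1 {x = x} = filter-some (≡-dec _≟B_ x)

count≥1⇒∈ : ∀ {l} {x : Vec Bool l} {xs} → 1 ≤ count x xs → x ∈ xs
count≥1⇒∈ {x = x} {y ∷ xs} c≥1 with ≡-dec _≟B_ x y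
... | yes x≡y = here x≡y
... | no _    = there (count≥1⇒∈ c≥1)

count≤count-∷ : ∀ {l} (x y : Vec Bool l) xs → count x xs ≤ count x (y ∷ xs)
count≤count-∷ x y xs with ≡-dec _≟B_ x y
... | yes _ = n≤1+n (count x xs)
... | no _  = ≤-refl

count-filter≤ : ∀ {l p} {P : Pred (Vec Bool l) p} (P? : Decidable P) x xs → count x (filter P? xs) ≤ count x xs
count-filter≤ P? x []       = z≤n
count-filter≤ P? x (y ∷ xs) with does (P? y)
... | false = ≤-trans (count-filter≤ P? x xs) (count≤count-∷ x y xs)
... | true with ≡-dec _≟B_ x y
...   | yes _ = s≤s (count-filter≤ P? x xs)
...   | no _  = count-filter≤ P? x xs

split : ∀ {j} → Subset j → List (Subset (suc j))
split A = (true ∷ A) ∷ (false ∷ A) ∷ []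

-- kSubsets m k filters a list built by a function local to its `where` block, which cannot be named
-- here and which also takes m and k as (unused) arguments.  allSubsets is a metavariable that the
-- unification in kSubsets-suc solves to that function; abstracting suc m and map split makes the
-- problem a pattern.
mutual
  allSubsets : ℕ → ℕ → (j : ℕ) → List (Subset j)
  allSubsets = _

  private
    kSubsets-suc : ∀ m k →
      kSubsets (suc m) k ≡ filter (λ A → ∣ A ∣ ≟ k) (concatMap split (allSubsets (suc m) k m))
    kSubsets-suc m k with suc m | map (split {m})
    ... | _ | _ = refl

count-concatMap-split : ∀ {j} b (E : Subset j) L → count (b ∷ E) (concatMap split L) ≡ count E L
count-concatMap-split b     E []      = refl
count-concatMap-split true  E (X ∷ L) with ≡-dec _≟B_ E X
... | yes _ = cong suc (count-concatMap-split true E L)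
... | no _  = count-concatMap-split true E L
count-concatMap-split false E (X ∷ L) with ≡-dec _≟B_ E X
... | yes _ = cong suc (count-concatMap-split false E L)
... | no _  = count-concatMap-split false E L

count-allSubsets : ∀ w k j (E : Subset j) → count E (allSubsets w k j) ≡ 1
count-allSubsets w k zero    []      = refl
count-allSubsets w k (suc j) (b ∷ E) =
  trans (count-concatMap-split b E (allSubsets w k j)) (count-allSubsets w k j E)

count-kSubsets≤1 : ∀ m k (E : Subset m) → count E (kSubsets m k) ≤ 1
count-kSubsets≤1 m k E =
  ≤-trans (count-filter≤ (λ A → ∣ A ∣ ≟ k) E (allSubsets m k m)) (≤-reflexive (count-allSubsets m k m E))

∈-kSubsets⇒∣∣≡ : ∀ {m k} {A : Subset m} → A ∈ kSubsets m k → ∣ A ∣ ≡ k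
∈-kSubsets⇒∣∣≡ {m} {k} A∈ = proj₂ (∈-filter⁻ (λ A → ∣ A ∣ ≟ k) {xs = allSubsets m k m} A∈)

∑δ≤1 : ∀ {l m} (u : Fin m → Vec Bool l) → Injective _≡_ _≡_ u → ∀ v → ∑[ b ∈ allFin m ] δ (u b) v ≤ 1
∑δ≤1 {m = zero}  u u-inj v = z≤n
∑δ≤1 {m = suc m} u u-inj v rewrite ∑-allFin-suc (λ b → δ (u b) v) with ≡-dec _≟B_ (u zero) v
... | yes u₀≡v =
  ≤-reflexive (cong suc (∑-zero (allFin m) (λ b → cong 𝟙 (dec-false (≡-dec _≟B_ (u (suc b)) v) (missed b)))))
  where
  missed : ∀ b → u (suc b) ≢ v
  missed b uₛ≡v = Fin.0≢1+n (u-inj (trans u₀≡v (sym uₛ≡v)))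
... | no _ = ∑δ≤1 (u ∘ suc) (Fin.suc-injective ∘ u-inj) v

∑δ*≤ : ∀ {l m} (u : Fin m → Vec Bool l) → Injective _≡_ _≡_ u → ∀ {v} (X : Fin m → ℕ) {B} →
  (∀ a → u a ≡ v → X a ≤ B) → ∑[ a ∈ allFin m ] δ (u a) v * X a ≤ B
∑δ*≤ {m = m} u u-inj {v} X {B} X≤B = begin
  ∑[ a ∈ allFin m ] δ (u a) v * X a  ≤⟨ ∑-mono-≤ (allFin m) (λ {a} _ → term a) ⟩
  ∑[ a ∈ allFin m ] δ (u a) v * B    ≡⟨ *-distribʳ-∑ B (allFin m) (λ a → δ (u a) v) ⟨
  (∑[ a ∈ allFin m ] δ (u a) v) * B  ≤⟨ *-monoˡ-≤ B (∑δ≤1 u u-inj v) ⟩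
  1 * B                              ≡⟨ *-identityˡ B ⟩
  B                                  ∎
  where
  open ≤-Reasoning
  term : ∀ a → δ (u a) v * X a ≤ δ (u a) v * B
  term a with ≡-dec _≟B_ (u a) v
  ... | yes uₐ≡v = *-monoʳ-≤ 1 (X≤B a uₐ≡v)
  ... | no _     = z≤n

count-map-injective : ∀ {l m} (u : Fin m → Vec Bool l) → Injective _≡_ _≡_ u →
  ∀ a → count (u a) (map u (allFin m)) ≡ 1
count-map-injective {m = m} u u-inj a = ≤-antisym atMostOne (∈⇒count≥1 (∈-map⁺ u (∈-allFin a)))
  where
  atMostOne : count (u a) (map u (allFin m)) ≤ 1
  atMostOne = begin
    count (u a) (map u (allFin m))      ≡⟨ count≡∑δ (u a) (map u (allFin m)) ⟩
    ∑[ y ∈ map u (allFin m) ] δ (u a) y ≡⟨ ∑-map u (allFin m) (δ (u a)) ⟩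
    ∑[ b ∈ allFin m ] δ (u a) (u b)     ≡⟨ ∑-cong (allFin m) (λ b → δ-sym (u a) (u b)) ⟩
    ∑[ b ∈ allFin m ] δ (u b) (u a)     ≤⟨ ∑δ≤1 u u-inj (u a) ⟩
    1                                   ∎
    where open ≤-Reasoning

∑-covered≤ : ∀ {l n} (xs : List (Vec Bool l)) → (∀ x → count x xs ≤ 1) →
  (e : Fin n → Vec Bool l) (P : Vec Bool l → Bool) (F : Vec Bool l → ℕ) →
  (∀ {x} → x ∈ xs → P x ≡ true → ∃[ i ] e i ≡ x) →
  ∑[ x ∈ xs ] 𝟙 (P x) * F x ≤ ∑[ i ∈ allFin n ] F (e i)
∑-covered≤ {n = n} xs unique e P F covered = begin
  ∑[ x ∈ xs ] 𝟙 (P x) * F x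
    ≤⟨ ∑-mono-≤ xs term≤ ⟩
  ∑[ x ∈ xs ] ∑[ i ∈ allFin n ] δ (e i) x * F (e i)
    ≡⟨ ∑-comm xs (allFin n) (λ x i → δ (e i) x * F (e i)) ⟩
  ∑[ i ∈ allFin n ] ∑[ x ∈ xs ] δ (e i) x * F (e i)
    ≡⟨ ∑-cong (allFin n) multiplicity ⟨
  ∑[ i ∈ allFin n ] count (e i) xs * F (e i)
    ≤⟨ ∑-mono-≤ (allFin n) (λ {i} _ → *-monoˡ-≤ (F (e i)) (unique (e i))) ⟩
  ∑[ i ∈ allFin n ] 1 * F (e i)
    ≡⟨ ∑-cong (allFin n) (λ i → *-identityˡ (F (e i))) ⟩
  ∑[ i ∈ allFin n ] F (e i)
    ∎
  where
  open ≤-Reasoning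
  term≤ : ∀ {x} → x ∈ xs → 𝟙 (P x) * F x ≤ ∑[ i ∈ allFin n ] δ (e i) x * F (e i)
  term≤ {x} x∈xs with P x in Px
  ... | false = z≤n
  ... | true with covered x∈xs Px
  ...   | i , refl = ≤-trans (≤-reflexive (cong (_* F (e i)) (sym (δ-refl (e i)))))
                             (∈⇒≤∑ (λ j → δ (e j) (e i) * F (e j)) (∈-allFin i))
  multiplicity : ∀ i → count (e i) xs * F (e i) ≡ ∑[ x ∈ xs ] δ (e i) x * F (e i)
  multiplicity i = trans (cong (_* F (e i)) (count≡∑δ (e i) xs)) (*-distribʳ-∑ (F (e i)) xs (δ (e i)))

SameDist-∈ : ∀ {l} {P Q : List (Vec Bool l)} {x} → SameDist P Q → 1 ≤ length Q → x ∈ P → x ∈ Q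
SameDist-∈ {P = P} {Q} {x} same Q≢[] x∈P =
  count≥1⇒∈ (positive (count x Q) (≤-trans (*-mono-≤ (∈⇒count≥1 x∈P) Q≢[]) (≤-reflexive (same x))))
  where
  positive : ∀ c → 1 ≤ c * length P → 1 ≤ c
  positive (suc c) _ = s≤s z≤n

module _ {l m} (u : Fin m → Vec Bool l) (u-inj : Injective _≡_ _≡_ u)
         (π : List (Vec Bool l × Vec Bool l)) (marginal : SameDist (map proj₁ π) (map u (allFin m))) where

  count-marginal : ∀ a → count (u a) (map proj₁ π) * m ≡ length π
  count-marginal a = begin
    count (u a) (map proj₁ π) * m
      ≡⟨ cong (count (u a) (map proj₁ π) *_) length-U ⟨
    count (u a) (map proj₁ π) * length (map u (allFin m))
      ≡⟨ marginal (u a) ⟩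
    count (u a) (map u (allFin m)) * length (map proj₁ π)
      ≡⟨ cong₂ _*_ (count-map-injective u u-inj a) (length-map proj₁ π) ⟩
    1 * length π
      ≡⟨ *-identityˡ (length π) ⟩
    length π
      ∎
    where
    open ≡-Reasoning
    length-U : length (map u (allFin m)) ≡ m
    length-U = trans (length-map u (allFin m)) (length-tabulate id)

  transport-bound : (W : Fin m → ℕ) (c : ℕ) → (∀ {a y} → (u a , y) ∈ π → W a ≤ c * ham (u a) y) →
    (∑[ a ∈ allFin m ] W a) * length π ≤ m * (c * cost π)
  transport-bound W c W≤ = begin
    (∑[ a ∈ allFin m ] W a) * length π
      ≡⟨ *-distribʳ-∑ (length π) (allFin m) W ⟩
    ∑[ a ∈ allFin m ] W a * length π
      ≡⟨ ∑-cong (allFin m) (λ a → cong (W a *_) (count-marginal a)) ⟨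
    ∑[ a ∈ allFin m ] W a * (count (u a) (map proj₁ π) * m)
      ≡⟨ ∑-cong (allFin m) (λ a → rearrange (W a) (count (u a) (map proj₁ π)) m) ⟩
    ∑[ a ∈ allFin m ] m * (count (u a) (map proj₁ π) * W a)
      ≡⟨ *-distribˡ-∑ m (allFin m) _ ⟨
    m * (∑[ a ∈ allFin m ] count (u a) (map proj₁ π) * W a)
      ≤⟨ *-monoʳ-≤ m weighted ⟩
    m * (c * cost π)
      ∎
    where
    open ≤-Reasoning
    rearrange : ∀ w n m → w * (n * m) ≡ m * (n * w)
    rearrange = solve-∀
    pointwise : ∀ {p} → p ∈ π →
      ∑[ a ∈ allFin m ] δ (u a) (proj₁ p) * W a ≤ c * ham (proj₁ p) (proj₂ p)
    pointwise {v , y} p∈π = ∑δ*≤ u u-inj W (λ { a refl → W≤ p∈π })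
    weighted : ∑[ a ∈ allFin m ] count (u a) (map proj₁ π) * W a ≤ c * cost π
    weighted = begin
      ∑[ a ∈ allFin m ] count (u a) (map proj₁ π) * W a
        ≡⟨ ∑-cong (allFin m) (λ a → cong (_* W a) (trans (count≡∑δ (u a) (map proj₁ π)) (∑-map proj₁ π (δ (u a))))) ⟩
      ∑[ a ∈ allFin m ] (∑[ p ∈ π ] δ (u a) (proj₁ p)) * W a
        ≡⟨ ∑-cong (allFin m) (λ a → *-distribʳ-∑ (W a) π _) ⟩
      ∑[ a ∈ allFin m ] ∑[ p ∈ π ] δ (u a) (proj₁ p) * W a
        ≡⟨ ∑-comm (allFin m) π _ ⟩
      ∑[ p ∈ π ] ∑[ a ∈ allFin m ] δ (u a) (proj₁ p) * W a
        ≤⟨ ∑-mono-≤ π pointwise ⟩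
      ∑[ p ∈ π ] c * ham (proj₁ p) (proj₂ p)
        ≡⟨ *-distribˡ-∑ c π _ ⟨
      c * cost π
        ∎

[k+1]*[n+1]C[k+1]≡[n+1]*nCk : ∀ n k → suc k * (suc n C suc k) ≡ suc n * (n C k)
[k+1]*[n+1]C[k+1]≡[n+1]*nCk zero    zero    = refl
[k+1]*[n+1]C[k+1]≡[n+1]*nCk zero    (suc k) = begin
  suc (suc k) * (1 C suc (suc k)) ≡⟨ cong (suc (suc k) *_) (k>n⇒nCk≡0 {1} {suc (suc k)} (s≤s (s≤s z≤n))) ⟩
  suc (suc k) * 0                 ≡⟨ *-zeroʳ (suc (suc k)) ⟩
  0                               ≡⟨ trans (+-identityʳ (0 C suc k)) (k>n⇒nCk≡0 {0} {suc k} (s≤s z≤n)) ⟨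
  1 * (0 C suc k)                 ∎
  where open ≡-Reasoning
[k+1]*[n+1]C[k+1]≡[n+1]*nCk (suc n) zero    =
  trans (+-identityʳ _) (trans (nC1≡n (suc (suc n))) (sym (*-identityʳ (suc (suc n)))))
[k+1]*[n+1]C[k+1]≡[n+1]*nCk (suc n) (suc k) = begin
  suc (suc k) * (suc (suc n) C suc (suc k))
    ≡⟨ cong (suc (suc k) *_) (nCk+nC[k+1]≡[n+1]C[k+1] (suc n) (suc k)) ⟨
  suc (suc k) * (a + suc n C suc (suc k))
    ≡⟨ *-distribˡ-+ (suc (suc k)) a _ ⟩
  (a + suc k * a) + suc (suc k) * (suc n C suc (suc k))
    ≡⟨ cong₂ _+_ (cong (a +_) ([k+1]*[n+1]C[k+1]≡[n+1]*nCk n k)) ([k+1]*[n+1]C[k+1]≡[n+1]*nCk n (suc k)) ⟩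
  (a + suc n * (n C k)) + suc n * (n C suc k)
    ≡⟨ trans (+-assoc a _ _) (cong (a +_) (sym (*-distribˡ-+ (suc n) (n C k) (n C suc k)))) ⟩
  a + suc n * (n C k + n C suc k)
    ≡⟨ cong (λ t → a + suc n * t) (nCk+nC[k+1]≡[n+1]C[k+1] n k) ⟩
  a + suc n * a ∎
  where
  open ≡-Reasoning
  a = suc n C suc k

k*nCk≡n*[n∸1]C[k∸1] : ∀ n k → 1 ≤ k → k * (n C k) ≡ n * ((n ∸ 1) C (k ∸ 1))
k*nCk≡n*[n∸1]C[k∸1] zero    (suc k) _ =
  trans (cong (suc k *_) (k>n⇒nCk≡0 {0} {suc k} (s≤s z≤n))) (*-zeroʳ (suc k))
k*nCk≡n*[n∸1]C[k∸1] (suc n) (suc k) _ = [k+1]*[n+1]C[k+1]≡[n+1]*nCk n k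

-- Replacing sel a by x keeps the Par condition applicable; both xors vanish and agree off a.
Phi-determinedByKey : ∀ {m k Cd pos Q} → InPar m k Cd pos Q → ∀ {A} → ∣ A ∣ ≡ k →
  (sel : Fin m → Bits2 m k) → (∀ b → lookup A b ≡ true → sel b ∈ Q × key m k Cd (sel b) ≡ just b) →
  ∀ {a x} → lookup A a ≡ true → x ∈ Q → key m k Cd x ≡ just a →
  Phi m k pos a x A ≡ Phi m k pos a (sel a) A
Phi-determinedByKey {m} {k} {Cd} {pos} {Q} par {A} size sel sel-keyed {a} {x} a∈A x∈Q x-key =
  trans (cong (λ y → Phi m k pos a y A) (sym (updateAt-updates a sel)))
        (xorF-cancel (lookup A) (λ b → Phi m k pos b (sel′ b) A) (λ b → Phi m k pos b (sel b) A) a∈A agree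
          (trans (proj₂ par A size sel′ sel′-keyed) (sym (proj₂ par A size sel sel-keyed))))
  where
  sel′ : Fin m → Bits2 m k
  sel′ = updateAt sel a (const x)
  agree : ∀ b → b ≢ a → Phi m k pos b (sel′ b) A ≡ Phi m k pos b (sel b) A
  agree b b≢a = cong (λ y → Phi m k pos b y A) (updateAt-minimal b a sel b≢a)
  sel′-keyed : ∀ b → lookup A b ≡ true → sel′ b ∈ Q × key m k Cd (sel′ b) ≡ just b
  sel′-keyed b b∈A with b ≟F a
  ... | yes refl rewrite updateAt-updates a {const x} sel = x∈Q , x-key
  ... | no b≢a   rewrite updateAt-minimal b a {const x} sel b≢a = sel-keyed b b∈A

uString-injective : ∀ {m k Cd} → IsSystematicCode m k Cd →
  ∀ enum f → Injective _≡_ _≡_ (uString m k Cd enum f)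
uString-injective {m} {Cd = Cd} (_ , prefix-injective) enum f {a} {b} uₐ≡u_b =
  prefix-injective a b (cong (prefixL m) (++-injectiveˡ (Cd a) (Cd b) uₐ≡u_b))

module Charging {m k : ℕ} (k≥1 : 1 ≤ k)
  (Cd : Fin m → Vec Bool (nn m k)) (sys : IsSystematicCode m k Cd)
  (enum : Fin m → Fin (nn m k) → Subset m) (pos : Fin m → Subset m → Fin (nn m k)) (ord : IsOrder m k enum pos)
  (f : Subset m → Vec Bool k) (Q : List (Bits2 m k)) (par : InPar m k Cd pos Q) where

  n : ℕ
  n = nn m k

  Keyed : Fin m → Bits2 m k → Set
  Keyed a x = key m k Cd x ≡ just a

  Supported : Fin m → Set
  Supported a = Any (Keyed a) Q

  supported? : ∀ a → Dec (Supported a)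
  supported? a = any? (λ x → ≡-decᴹ _≟F_ (key m k Cd x) (just a)) Q

  -- Junk at keys of no string of Q; only used at supported keys.
  representative : Fin m → Bits2 m k
  representative a with supported? a
  ... | yes s = proj₁ (find s)
  ... | no _  = replicate _ false

  representative-keyed : ∀ {a} → Supported a → representative a ∈ Q × Keyed a (representative a)
  representative-keyed {a} s with supported? a
  ... | yes s′ = proj₂ (find s′)
  ... | no ¬s  = contradiction s ¬s

  MissingKey : Subset m → Set
  MissingKey A = ∃[ b ] (lookup A b ≡ true × ¬ Supported b)

  missingKey? : ∀ A → Dec (MissingKey A)
  missingKey? A = Fin.any? (λ b → (lookup A b ≟B true) ×-dec ¬? (supported? b))

  representatives-keyed : ∀ {A} → ¬ MissingKey A →
    ∀ b → lookup A b ≡ true → representative b ∈ Q × Keyed b (representative b)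
  representatives-keyed none b b∈A =
    representative-keyed (decidable-stable (supported? b) (λ ¬s → none (b , b∈A , ¬s)))

  charge : Fin m → Subset m → ℕ
  charge a A with missingKey? A
  ... | yes _ = 𝟙 (not (does (supported? a)))
  ... | no _  = 𝟙 (Phi m k pos a (representative a) A xor ordBit (f A) A a)

  charge≤1 : ∀ a A → charge a A ≤ 1
  charge≤1 a A with missingKey? A
  ... | yes _ = 𝟙≤1 _
  ... | no _  = 𝟙≤1 _

  oddSet-charged : ∀ {A} → ∣ A ∣ ≡ k → parity (f A) ≡ true →
    ∃[ a ] (lookup A a ≡ true × charge a A ≡ 1)
  oddSet-charged {A} size odd with missingKey? A
  ... | yes (b , b∈A , ¬s) = b , b∈A , cong (𝟙 ∘ not) (dec-false (supported? b) ¬s)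
  ... | no none = Product.map id (Product.map id (cong 𝟙 ∘ disagree)) (xorF-≢ (lookup A) _ _ Phi≢ordBit)
    where
    disagree : ∀ {x y} → x ≢ y → x xor y ≡ true
    disagree {false} {false} x≢y = contradiction refl x≢y
    disagree {false} {true}  _   = refl
    disagree {true}  {false} _   = refl
    disagree {true}  {true}  x≢y = contradiction refl x≢y
    Phi≢ordBit :
      xorF (lookup A) (λ a → Phi m k pos a (representative a) A) ≢ xorF (lookup A) (ordBit (f A) A)
    Phi≢ordBit eq with trans (sym (proj₂ par A size representative (representatives-keyed {A} none)))
                             (trans eq (trans (sym (parity≡xorF-ordBit A (f A) size)) odd))
    ... | ()

  parity≤charges : ∀ {A} → ∣ A ∣ ≡ k →
    𝟙 (parity (f A)) ≤ ∑[ a ∈ allFin m ] 𝟙 (lookup A a) * charge a A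
  parity≤charges {A} size with parity (f A) in odd
  ... | false = z≤n
  ... | true with oddSet-charged size odd
  ...   | a , a∈A , charged = ≤-trans (≤-reflexive (sym (cong₂ _*_ (cong 𝟙 a∈A) charged)))
                                      (∈⇒≤∑ (λ a → 𝟙 (lookup A a) * charge a A) (∈-allFin a))

  addKey : Fin m → Fin n → Subset m
  addKey a i = enum a i ∪ ⁅ a ⁆

  totalCharge : Fin m → ℕ
  totalCharge a = ∑[ i ∈ allFin n ] charge a (addKey a i)

  addKey-covers : ∀ a {A} → A ∈ kSubsets m k → lookup A a ≡ true → ∃[ i ] addKey a i ≡ A
  addKey-covers a {A} A∈ a∈A =
    pos a (A - a) , trans (cong (_∪ ⁅ a ⁆) (proj₂ (proj₂ ord) a (A - a) size (x∉p-x A a))) (p-x∪⁅x⁆≡p A a a∈A)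
    where
    size : ∣ A - a ∣ ≡ k ∸ 1
    size = cong (_∸ 1) (trans (∣p-x∣+1≡∣p∣ A a a∈A) (∈-kSubsets⇒∣∣≡ A∈))

  distF-fixParity≤totalCharge : distF m k f (fixParity ∘ f) ≤ ∑[ a ∈ allFin m ] totalCharge a
  distF-fixParity≤totalCharge = begin
    distF m k f (fixParity ∘ f)
      ≡⟨ ∑-cong (kSubsets m k) (ham-fixParity ∘ f) ⟩
    ∑[ A ∈ kSubsets m k ] 𝟙 (parity (f A))
      ≤⟨ ∑-mono-≤ (kSubsets m k) (parity≤charges ∘ ∈-kSubsets⇒∣∣≡) ⟩
    ∑[ A ∈ kSubsets m k ] ∑[ a ∈ allFin m ] 𝟙 (lookup A a) * charge a A
      ≡⟨ ∑-comm (kSubsets m k) (allFin m) _ ⟩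
    ∑[ a ∈ allFin m ] ∑[ A ∈ kSubsets m k ] 𝟙 (lookup A a) * charge a A
      ≤⟨ ∑-mono-≤ (allFin m) (λ {a} _ → chargesVia a) ⟩
    ∑[ a ∈ allFin m ] totalCharge a
      ∎
    where
    open ≤-Reasoning
    chargesVia : ∀ a → ∑[ A ∈ kSubsets m k ] 𝟙 (lookup A a) * charge a A ≤ totalCharge a
    chargesVia a = ∑-covered≤ (kSubsets m k) (count-kSubsets≤1 m k) (addKey a) (λ A → lookup A a) (charge a)
                              (addKey-covers a)

  uTail : Fin m → Fin n → Bool
  uTail a i = ordBit (f (addKey a i)) (addKey a i) a

  ∣addKey∣ : ∀ a i → ∣ addKey a i ∣ ≡ k
  ∣addKey∣ a i = trans (∣p∪⁅x⁆∣≡∣p∣+1 (enum a i) a (proj₂ (proj₁ ord a i)))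
                       (trans (cong suc (proj₁ (proj₁ ord a i))) (trans (+-comm 1 (k ∸ 1)) (m∸n+n≡m k≥1)))

  Phi-addKey : ∀ a i x → Phi m k pos a x (addKey a i) ≡ lookup (drop n x) i
  Phi-addKey a i x = cong (lookup (drop n x))
    (trans (cong (pos a) (p∪⁅x⁆-x≡p (enum a i) a (proj₂ (proj₁ ord a i)))) (proj₁ (proj₂ ord) a i))

  ham-uString : ∀ a x →
    ham (uString m k Cd enum f a) x ≡ ham (Cd a) (take n x) + ham (tabulateᵛ (uTail a)) (drop n x)
  ham-uString a = ham-++-split (Cd a) (tabulateᵛ (uTail a))

  charge-atKey : ∀ {a x} i → x ∈ Q → Keyed a x →
    charge a (addKey a i) ≤ 𝟙 (uTail a i xor lookup (drop n x) i)
  charge-atKey {a} {x} i x∈Q x-key with missingKey? (addKey a i)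
  ... | yes _ rewrite dec-true (supported? a) (lose x∈Q x-key) = z≤n
  ... | no none =
    ≤-reflexive (cong 𝟙 (trans (cong (_xor uTail a i) representative≡x)
                               (xor-comm (lookup (drop n x) i) (uTail a i))))
    where
    representative≡x : Phi m k pos a (representative a) (addKey a i) ≡ lookup (drop n x) i
    representative≡x = trans
      (sym (Phi-determinedByKey {pos = pos} par (∣addKey∣ a i) representative
                                (representatives-keyed {addKey a i} none) (x∈p∪⁅x⁆ (enum a i) a) x∈Q x-key))
      (Phi-addKey a i x)

  totalCharge≤ : ∀ {a x} → x ∈ Q → totalCharge a ≤ 3 * ham (uString m k Cd enum f a) x
  totalCharge≤ {a} {x} x∈Q with proj₁ par x x∈Q
  ... | a′ , x-key , x-prefix with a′ ≟F a
  ...   | yes refl = begin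
    totalCharge a                                                ≤⟨ ∑-mono-≤ (allFin n) (λ {i} _ → charge-atKey i x∈Q x-key) ⟩
    ∑[ i ∈ allFin n ] 𝟙 (uTail a i xor lookup (drop n x) i)      ≡⟨ ham-tabulate (uTail a) (drop n x) ⟨
    ham (tabulateᵛ (uTail a)) (drop n x)                         ≤⟨ m≤n+m _ _ ⟩
    ham (Cd a) (take n x) + ham (tabulateᵛ (uTail a)) (drop n x) ≡⟨ ham-uString a x ⟨
    ham (uString m k Cd enum f a) x                              ≤⟨ m≤n*m _ 3 ⟩
    3 * ham (uString m k Cd enum f a) x                          ∎
    where open ≤-Reasoning
  ...   | no a′≢a = begin
    totalCharge a                                                      ≤⟨ ∑≤length (allFin n) (charge≤1 a ∘ addKey a) ⟩
    length (allFin n)                                                  ≡⟨ length-tabulate id ⟩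
    n                                                                  ≤⟨ proj₁ sys a a′ (a′≢a ∘ sym) ⟩
    3 * ham (Cd a) (Cd a′)                                             ≡⟨ cong (λ y → 3 * ham (Cd a) y) x-prefix ⟨
    3 * ham (Cd a) (take n x)                                          ≤⟨ *-monoʳ-≤ 3 (m≤m+n (ham (Cd a) (take n x)) _) ⟩
    3 * (ham (Cd a) (take n x) + ham (tabulateᵛ (uTail a)) (drop n x)) ≡⟨ cong (3 *_) (ham-uString a x) ⟨
    3 * ham (uString m k Cd enum f a) x                                ∎
    where open ≤-Reasoning

mainTheorem19 : (m k : ℕ) → 2 ≤ k →
    (Cd : Fin m → Vec Bool (nn m k)) → IsSystematicCode m k Cd →
    (enum : Fin m → Fin (nn m k) → Subset m) → (pos : Fin m → Subset m → Fin (nn m k)) →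
    IsOrder m k enum pos →
    (f : Subset m → Vec Bool k) →
    (Q : List (Bits2 m k)) → 1 ≤ length Q → InPar m k Cd pos Q →
    (π : List (Bits2 m k × Bits2 m k)) → IsCoupling (U m k Cd enum f) Q π →
    ∃[ g ] (InParF m k g ×
      distF m k f g * ((nn m k + nn m k) * length π) ≤ 6 * cost π * (k * (m C k)))
mainTheorem19 m k k≥2 Cd sys enum pos ord f Q Q≢[] par π (_ , marginal₁ , marginal₂) =
  fixParity ∘ f , (λ A _ → parity-fixParity (f A)) , bound
  where
  open Charging (<⇒≤ k≥2) Cd sys enum pos ord f Q par
  transport : (∑[ a ∈ allFin m ] totalCharge a) * length π ≤ m * (3 * cost π)
  transport = transport-bound (uString m k Cd enum f) (uString-injective sys enum f) π marginal₁ totalCharge 3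
                (λ p∈π → totalCharge≤ (SameDist-∈ marginal₂ Q≢[] (∈-map⁺ proj₂ p∈π)))
  rearrange : ∀ d n l → d * ((n + n) * l) ≡ (n + n) * (d * l)
  rearrange = solve-∀
  rearrange′ : ∀ n m c → (n + n) * (m * (3 * c)) ≡ 6 * c * (m * n)
  rearrange′ = solve-∀
  bound : distF m k f (fixParity ∘ f) * ((n + n) * length π) ≤ 6 * cost π * (k * (m C k))
  bound = begin
    distF m k f (fixParity ∘ f) * ((n + n) * length π)       ≤⟨ *-monoˡ-≤ _ distF-fixParity≤totalCharge ⟩
    (∑[ a ∈ allFin m ] totalCharge a) * ((n + n) * length π) ≡⟨ rearrange (∑ (allFin m) totalCharge) n (length π) ⟩
    (n + n) * ((∑[ a ∈ allFin m ] totalCharge a) * length π) ≤⟨ *-monoʳ-≤ (n + n) transport ⟩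
    (n + n) * (m * (3 * cost π))                             ≡⟨ rearrange′ n m (cost π) ⟩
    6 * cost π * (m * n)                                     ≡⟨ cong (6 * cost π *_) (k*nCk≡n*[n∸1]C[k∸1] m k (<⇒≤ k≥2)) ⟨
    6 * cost π * (k * (m C k))                               ∎
    where open ≤-Reasoning
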